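{- Let $b\ge3$ be odd and let $a=a(b,i)$ be the $i$-th input of the complete MDS system. Let $(q_j)_{j\ge0}$ be the unsigned Schick sequence $q_0=a$, $q_j=|b-2q_{j-1}|$ for $j\ge1$. It is periodic with primitive period $\mathrm{pes}(b)$, so $q_{\mathrm{pes}(b)+l}=q_l$ for $l\ge0$. Let $MDS(b,i)=(c_1,\dots,c_{P(b)})$ be the primitive period of $c_j=\mathrm{mod}^*(a2^j,b)$, $j\ge1$. Then $$c_j=\tfrac12\big(b-q_{j+1}\big)\qquad\text{for } j=1,\dots,P(b).$$ In particular $c_{P(b)}=q_0=a$.
   Context: For odd $b\ge3$: - $RRS^*(b)=\{r\in\mathbb Z:1\le r\le(b-1)/2,\ \gcd(r,b)=1\}$. - For $m$ coprime to $b$, $\mathrm{mod}^*(m,b)=\mathrm{mod}(m,b)$ if the least non-negative residue $\mathrm{mod}(m,b)$ is $\le b/2$, and $\mathrm{mod}^*(m,b)=\mathrm{mod}(-m,b)$ otherwise. - MDS inputs: $a(b,1)=1$, and $a(b,i+1)$ is the smallest odd element of $RRS^*(b)$ not occurring in the sequences with earlier inputs. - $P(b)=\mathrm{pes}(b)$ is the common primitive period. -}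

module Defs where

open import Data.Nat using (ℕ; zero; suc; _+_; _*_; _∸_; _^_; _≤_; _<_; _≤ᵇ_; ∣_-_∣)
open import Data.Nat.DivMod using (_%_)
open import Data.Nat.Coprimality using (Coprime)
open import Data.Bool using (if_then_else_)
open import Data.List using (List; []; _∷_)
open import Data.List.Relation.Unary.Any using (Any)
open import Data.Product using (_×_; ∃-syntax)
open import Relation.Binary.PropositionalEquality using (_≡_)
open import Relation.Nullary using (¬_)

-- mod*(m,b): least non-negative residue r = mod(m,b) if r ≤ b/2 (i.e. 2r ≤ b),
-- otherwise mod(-m,b) = b - r.  (b = 0 is never used; we return 0.)
modStar : ℕ → ℕ → ℕ
modStar zero    m = 0
modStar (suc k) m = if 2 * r ≤ᵇ suc k then r else suc k ∸ r
  where r = m % suc k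

schick : ℕ → ℕ → ℕ → ℕ
schick b a zero    = a
schick b a (suc j) = ∣ b - 2 * schick b a j ∣

InRRS* : ℕ → ℕ → Set
InRRS* b r = 1 ≤ r × 2 * r ≤ b ∸ 1 × Coprime r b

OddN : ℕ → Set
OddN r = r % 2 ≡ 1

Seen : ℕ → List ℕ → ℕ → Set
Seen b as y = Any (λ x → ∃[ j ] (1 ≤ j × modStar b (x * 2 ^ j) ≡ y)) as

IsNext : ℕ → List ℕ → ℕ → Set
IsNext b as a =
  InRRS* b a × OddN a × ¬ Seen b as a ×
  (∀ r → InRRS* b r → OddN r → ¬ Seen b as r → a ≤ r)

-- InputsRev b (a_k ∷ … ∷ a_1 ∷ []) : the list is the first k MDS inputs, in reverse order
data InputsRev (b : ℕ) : List ℕ → Set where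
  first : InputsRev b (1 ∷ [])
  next  : ∀ {as a} → InputsRev b as → IsNext b as a → InputsRev b (a ∷ as)

IsMDSInput : ℕ → ℕ → ℕ → Set
IsMDSInput b i a = ∃[ as ] (InputsRev b (a ∷ as) × Data.List.length (a ∷ as) ≡ i)

IsPrimitivePeriod : (ℕ → ℕ) → ℕ → Set
IsPrimitivePeriod f P =
  1 ≤ P × (∀ n → f (n + P) ≡ f n) ×
  (∀ k → 1 ≤ k → k < P → ¬ (∀ n → f (n + k) ≡ f n))

-- P = pes(b): the (common) primitive period of the Schick sequences, taken for a(b,1) = 1
IsPes : ℕ → ℕ → Set
IsPes b P = IsPrimitivePeriod (schick b 1) P

{-# OPTIONS --safe #-}
module Submission where

open import Defs
open import Data.Nat using (ℕ; suc; zero; s≤s; _+_; _*_; _^_; _≤_; _<_; _∸_; _≤ᵇ_; ∣_-_∣; NonZero)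
open import Data.Nat.DivMod
  using (_%_; %-distribˡ-+; %-distribˡ-*; %-remove-+ˡ; %-remove-+ʳ; m%n%n≡m%n; m%n≤n; m<n⇒m%n≡m; n%n≡0; m*n%n≡0)
open import Data.Nat.Divisibility using (_∣_; m%n≡0⇒n∣m; n∣m⇒m%n≡0; ∣n⇒∣m*n)
open import Data.Nat.Properties
open import Data.Bool using (T; true; false)
open import Data.Unit using (tt)
open import Data.Sum using (_⊎_; inj₁; inj₂)
open import Data.Product using (_×_; _,_)
open import Data.Empty using (⊥-elim)
open import Data.List using (_∷_)
open import Relation.Binary.PropositionalEquality

-- Write c_j = mod*(a 2^j, b).  For odd b, mod*(m, b) is the unique c with 2c < b and
-- c ≡ ±m (mod b), so c_(j+1) = mod*(2 c_j, b), which is 2 c_j or b − 2 c_j according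
-- as 4 c_j < b or not.  If q_(j+1) = b − 2 c_j, then q_(j+2) = |b − 2 q_(j+1)| = |4 c_j − b|,
-- and the two case distinctions match: q_(j+2) = b − 2 c_(j+1).  For a = 1 and j = P,
-- periodicity gives q_(P+1) = q_1 = b − 2, hence 2^P ≡ ±1, hence a 2^P ≡ ±a and c_P = a.

+-cong-% : ∀ {n} .{{_ : NonZero n}} {m m′ o o′} →
           m % n ≡ m′ % n → o % n ≡ o′ % n → (m + o) % n ≡ (m′ + o′) % n
+-cong-% {n} {m} {m′} {o} {o′} m≡m′ o≡o′ = begin
  (m + o) % n             ≡⟨ %-distribˡ-+ m o n ⟩
  (m % n + o % n) % n     ≡⟨ cong₂ (λ x y → (x + y) % n) m≡m′ o≡o′ ⟩
  (m′ % n + o′ % n) % n   ≡⟨ %-distribˡ-+ m′ o′ n ⟨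
  (m′ + o′) % n           ∎
  where open ≡-Reasoning

*-congˡ-% : ∀ {n} .{{_ : NonZero n}} t {m m′} → m % n ≡ m′ % n → (t * m) % n ≡ (t * m′) % n
*-congˡ-% {n} t {m} {m′} m≡m′ = begin
  (t * m) % n             ≡⟨ %-distribˡ-* t m n ⟩
  (t % n * (m % n)) % n   ≡⟨ cong (λ x → (t % n * x) % n) m≡m′ ⟩
  (t % n * (m′ % n)) % n  ≡⟨ %-distribˡ-* t m′ n ⟨
  (t * m′) % n            ∎
  where open ≡-Reasoning

infix 4 _≡±_[mod_]

_≡±_[mod_] : ℕ → ℕ → (n : ℕ) → .{{NonZero n}} → Set
m ≡± c [mod n ] = m % n ≡ c % n ⊎ n ∣ m + c

module _ {n : ℕ} .{{_ : NonZero n}} where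

  ≡±-reflexive : ∀ {m c} → m ≡ c → m ≡± c [mod n ]
  ≡±-reflexive m≡c = inj₁ (cong (_% n) m≡c)

  ≡±-sym : ∀ {m c} → m ≡± c [mod n ] → c ≡± m [mod n ]
  ≡±-sym         (inj₁ m≡c)  = inj₁ (sym m≡c)
  ≡±-sym {m} {c} (inj₂ n∣m+c) = inj₂ (subst (n ∣_) (+-comm m c) n∣m+c)

  ≡±-trans : ∀ {x y z} → x ≡± y [mod n ] → y ≡± z [mod n ] → x ≡± z [mod n ]
  ≡±-trans         (inj₁ x≡y)   (inj₁ y≡z)   = inj₁ (trans x≡y y≡z)
  ≡±-trans {x} {y} {z} (inj₁ x≡y) (inj₂ n∣y+z) =
    inj₂ (m%n≡0⇒n∣m (x + z) n (trans (+-cong-% x≡y refl) (n∣m⇒m%n≡0 (y + z) n n∣y+z)))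
  ≡±-trans (inj₂ n∣x+y) (inj₁ y≡z) = ≡±-sym (≡±-trans (inj₁ (sym y≡z)) (≡±-sym (inj₂ n∣x+y)))
  ≡±-trans {x} {y} {z} (inj₂ n∣x+y) (inj₂ n∣y+z) = inj₁ (begin
    x % n             ≡⟨ %-remove-+ʳ x n∣y+z ⟨
    (x + (y + z)) % n ≡⟨ cong (_% n) (+-assoc x y z) ⟨
    (x + y + z) % n   ≡⟨ %-remove-+ˡ z n∣x+y ⟩
    z % n             ∎)
    where open ≡-Reasoning

  ≡±-*ˡ : ∀ t {m c} → m ≡± c [mod n ] → t * m ≡± t * c [mod n ]
  ≡±-*ˡ t (inj₁ m≡c) = inj₁ (*-congˡ-% t m≡c)
  ≡±-*ˡ t {m} {c} (inj₂ n∣m+c) = inj₂ (subst (n ∣_) (*-distribˡ-+ t m c) (∣n⇒∣m*n t n∣m+c))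

  ≡±-unique : ∀ {c c′} → 2 * c < n → 2 * c′ < n → c ≡± c′ [mod n ] → c ≡ c′
  ≡±-unique {c} {c′} 2c<n 2c′<n (inj₁ c≡c′) = begin
    c       ≡⟨ m<n⇒m%n≡m (half<⇒< 2c<n) ⟨
    c % n   ≡⟨ c≡c′ ⟩
    c′ % n  ≡⟨ m<n⇒m%n≡m (half<⇒< 2c′<n) ⟩
    c′      ∎
    where
    open ≡-Reasoning
    half<⇒< : ∀ {x} → 2 * x < n → x < n
    half<⇒< {x} = ≤-<-trans (m≤n*m x 2)
  ≡±-unique {c} {c′} 2c<n 2c′<n (inj₂ n∣c+c′) = trans (m+n≡0⇒m≡0 c c+c′≡0) (sym (m+n≡0⇒n≡0 c c+c′≡0))
    where
    c+c′<n : c + c′ < n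
    c+c′<n = *-cancelˡ-< 2 (c + c′) n (begin-strict
      2 * (c + c′)    ≡⟨ *-distribˡ-+ 2 c c′ ⟩
      2 * c + 2 * c′  <⟨ +-mono-< 2c<n 2c′<n ⟩
      n + n           ≡⟨ cong (n +_) (+-identityʳ n) ⟨
      2 * n           ∎)
      where open ≤-Reasoning
    c+c′≡0 : c + c′ ≡ 0
    c+c′≡0 = trans (sym (m<n⇒m%n≡m c+c′<n)) (n∣m⇒m%n≡0 (c + c′) n n∣c+c′)

m≤n⇒m+∣n-m∣≡n : ∀ {m n} → m ≤ n → m + ∣ n - m ∣ ≡ n
m≤n⇒m+∣n-m∣≡n {m} m≤n = trans (cong (m +_) (m≤n⇒∣n-m∣≡n∸m m≤n)) (m+[n∸m]≡n m≤n)

m≤n⇒2m+∣m-n∣≡m+n : ∀ {m n} → m ≤ n → 2 * m + ∣ m - n ∣ ≡ m + n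
m≤n⇒2m+∣m-n∣≡m+n {m} {n} m≤n = begin
  2 * m + ∣ m - n ∣        ≡⟨ cong (_+ ∣ m - n ∣) (cong (m +_) (+-identityʳ m)) ⟩
  m + m + ∣ m - n ∣        ≡⟨ +-assoc m m ∣ m - n ∣ ⟩
  m + (m + ∣ m - n ∣)      ≡⟨ cong (λ d → m + (m + d)) (∣-∣-comm m n) ⟩
  m + (m + ∣ n - m ∣)      ≡⟨ cong (m +_) (m≤n⇒m+∣n-m∣≡n m≤n) ⟩
  m + n                    ∎
  where open ≡-Reasoning

∣[m+n]-2n∣≡∣m-n∣ : ∀ m n → ∣ m + n - 2 * n ∣ ≡ ∣ m - n ∣
∣[m+n]-2n∣≡∣m-n∣ m n = begin
  ∣ m + n - 2 * n ∣        ≡⟨ cong₂ ∣_-_∣ (+-comm m n) (cong (n +_) (+-identityʳ n)) ⟩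
  ∣ n + m - n + n ∣        ≡⟨ ∣m+n-m+o∣≡∣n-o∣ n m n ⟩
  ∣ m - n ∣                ∎
  where open ≡-Reasoning

n≤2m⇒2[n∸m]≤n : ∀ {m n} → n ≤ 2 * m → 2 * (n ∸ m) ≤ n
n≤2m⇒2[n∸m]≤n {m} {n} n≤2m = begin
  2 * (n ∸ m)      ≡⟨ *-distribˡ-∸ 2 n m ⟩
  2 * n ∸ 2 * m    ≤⟨ ∸-monoʳ-≤ (2 * n) n≤2m ⟩
  2 * n ∸ n        ≡⟨ cong (_∸ n) (cong (n +_) (+-identityʳ n)) ⟩
  n + n ∸ n        ≡⟨ m+n∸n≡m n n ⟩
  n                ∎
  where open ≤-Reasoning

2m≤odd⇒2m<odd : ∀ {m n} → n % 2 ≡ 1 → 2 * m ≤ n → 2 * m < n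
2m≤odd⇒2m<odd {m} {n} n-odd 2m≤n with m≤n⇒m<n∨m≡n 2m≤n
... | inj₁ 2m<n = 2m<n
... | inj₂ 2m≡n = ⊥-elim (0≢1+n (begin
  0              ≡⟨ m*n%n≡0 m 2 ⟨
  (m * 2) % 2    ≡⟨ cong (_% 2) (*-comm m 2) ⟩
  (2 * m) % 2    ≡⟨ cong (_% 2) 2m≡n ⟩
  n % 2          ≡⟨ n-odd ⟩
  1              ∎))
  where open ≡-Reasoning

modStar-≤ : ∀ {n} .{{_ : NonZero n}} m → 2 * (m % n) ≤ n → modStar n m ≡ m % n
modStar-≤ {suc k} m 2r≤n with 2 * (m % suc k) ≤ᵇ suc k | ≤⇒≤ᵇ 2r≤n
... | true | _ = refl

modStar-> : ∀ {n} .{{_ : NonZero n}} m → n < 2 * (m % n) → modStar n m ≡ n ∸ m % n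
modStar-> {suc k} m n<2r with 2 * (m % suc k) ≤ᵇ suc k in 2r≤ᵇn
... | true  = ⊥-elim (<⇒≱ n<2r (≤ᵇ⇒≤ _ _ (subst T (sym 2r≤ᵇn) tt)))
... | false = refl

modStar-half : ∀ {n} .{{_ : NonZero n}} m → 2 * modStar n m ≤ n
modStar-half {n} m with ≤-<-connex (2 * (m % n)) n
... | inj₁ 2r≤n = subst (λ c → 2 * c ≤ n) (sym (modStar-≤ m 2r≤n)) 2r≤n
... | inj₂ n<2r = subst (λ c → 2 * c ≤ n) (sym (modStar-> m n<2r)) (n≤2m⇒2[n∸m]≤n {m % n} (<⇒≤ n<2r))

modStar-≡± : ∀ {n} .{{_ : NonZero n}} m → m ≡± modStar n m [mod n ]
modStar-≡± {n} m with ≤-<-connex (2 * (m % n)) n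
... | inj₁ 2r≤n = inj₁ (trans (sym (m%n%n≡m%n m n)) (cong (_% n) (sym (modStar-≤ m 2r≤n))))
... | inj₂ n<2r = inj₂ (subst (λ c → n ∣ m + c) (sym (modStar-> m n<2r)) (m%n≡0⇒n∣m _ n (begin
  (m + (n ∸ m % n)) % n      ≡⟨ +-cong-% (sym (m%n%n≡m%n m n)) refl ⟩
  (m % n + (n ∸ m % n)) % n  ≡⟨ cong (_% n) (m+[n∸m]≡n (m%n≤n m n)) ⟩
  n % n                      ≡⟨ n%n≡0 n ⟩
  0                          ∎)))
  where open ≡-Reasoning

modStar-below : ∀ {n m} .{{_ : NonZero n}} → m < n → 2 * m ≤ n → modStar n m ≡ m
modStar-below {n} {m} m<n 2m≤n =
  trans (modStar-≤ m (subst (λ r → 2 * r ≤ n) (sym m%n≡m) 2m≤n)) m%n≡m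
  where
  m%n≡m : m % n ≡ m
  m%n≡m = m<n⇒m%n≡m m<n

modStar-above : ∀ {n m} .{{_ : NonZero n}} → m < n → n < 2 * m → modStar n m ≡ n ∸ m
modStar-above {n} {m} m<n n<2m =
  trans (modStar-> m (subst (λ r → n < 2 * r) (sym m%n≡m) n<2m)) (cong (n ∸_) m%n≡m)
  where
  m%n≡m : m % n ≡ m
  m%n≡m = m<n⇒m%n≡m m<n

modStar-double-step : ∀ {n x q} .{{_ : NonZero n}} →
                      x < n → x + q ≡ n → 2 * modStar n x + ∣ n - 2 * q ∣ ≡ n
modStar-double-step {x = x} {q} x<n refl with ≤-<-connex x q
... | inj₁ x≤q = begin
  2 * modStar (x + q) x + ∣ x + q - 2 * q ∣  ≡⟨ cong₂ _+_ (cong (2 *_) (modStar-below x<n 2x≤x+q))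
                                                          (∣[m+n]-2n∣≡∣m-n∣ x q) ⟩
  2 * x + ∣ x - q ∣                           ≡⟨ m≤n⇒2m+∣m-n∣≡m+n x≤q ⟩
  x + q                                       ∎
  where
  open ≡-Reasoning
  2x≤x+q : 2 * x ≤ x + q
  2x≤x+q = subst (_≤ x + q) (cong (x +_) (sym (+-identityʳ x))) (+-monoʳ-≤ x x≤q)
... | inj₂ q<x = begin
  2 * modStar (x + q) x + ∣ x + q - 2 * q ∣  ≡⟨ cong₂ _+_ (cong (2 *_) (modStar-above x<n x+q<2x))
                                                          (∣[m+n]-2n∣≡∣m-n∣ x q) ⟩
  2 * (x + q ∸ x) + ∣ x - q ∣                 ≡⟨ cong₂ (λ c d → 2 * c + d) (m+n∸m≡n x q) (∣-∣-comm x q) ⟩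
  2 * q + ∣ q - x ∣                           ≡⟨ m≤n⇒2m+∣m-n∣≡m+n (<⇒≤ q<x) ⟩
  q + x                                       ≡⟨ +-comm q x ⟩
  x + q                                       ∎
  where
  open ≡-Reasoning
  x+q<2x : x + q < 2 * x
  x+q<2x = subst (x + q <_) (cong (x +_) (sym (+-identityʳ x))) (+-monoʳ-< x q<x)

module _ {n : ℕ} .{{_ : NonZero n}} (n-odd : n % 2 ≡ 1) where

  modStar-< : ∀ m → 2 * modStar n m < n
  modStar-< m = 2m≤odd⇒2m<odd {modStar n m} n-odd (modStar-half m)

  modStar-unique : ∀ {m c} → m ≡± c [mod n ] → 2 * c < n → modStar n m ≡ c
  modStar-unique {m} r 2c<n = ≡±-unique (modStar-< m) 2c<n (≡±-trans (≡±-sym (modStar-≡± m)) r)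

  modStar-cong : ∀ {m m′} → m ≡± m′ [mod n ] → modStar n m ≡ modStar n m′
  modStar-cong {m′ = m′} r = modStar-unique (≡±-trans r (modStar-≡± m′)) (modStar-< m′)

  modStar-schick : ∀ {a} → 2 * a < n → ∀ j → 2 * modStar n (a * 2 ^ j) + schick n a (suc j) ≡ n
  modStar-schick {a} 2a<n zero = begin
    2 * modStar n (a * 1) + ∣ n - 2 * a ∣  ≡⟨ cong (λ c → 2 * c + ∣ n - 2 * a ∣)
                                                (modStar-unique (≡±-reflexive (*-identityʳ a)) 2a<n) ⟩
    2 * a + ∣ n - 2 * a ∣                  ≡⟨ m≤n⇒m+∣n-m∣≡n (<⇒≤ 2a<n) ⟩
    n                                      ∎
    where open ≡-Reasoning
  modStar-schick {a} 2a<n (suc j) = begin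
    2 * modStar n (a * 2 ^ suc j) + ∣ n - 2 * q ∣  ≡⟨ cong (λ c → 2 * c + ∣ n - 2 * q ∣)
                                                        (modStar-cong a2^[1+j]≡±2c) ⟩
    2 * modStar n (2 * c) + ∣ n - 2 * q ∣          ≡⟨ modStar-double-step (modStar-< (a * 2 ^ j))
                                                        (modStar-schick 2a<n j) ⟩
    n                                              ∎
    where
    open ≡-Reasoning
    c = modStar n (a * 2 ^ j)
    q = schick n a (suc j)
    a*[2*t]≡2*[a*t] : ∀ t → a * (2 * t) ≡ 2 * (a * t)
    a*[2*t]≡2*[a*t] t = trans (sym (*-assoc a 2 t)) (trans (cong (_* t) (*-comm a 2)) (*-assoc 2 a t))
    a2^[1+j]≡±2c : a * 2 ^ suc j ≡± 2 * c [mod n ]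
    a2^[1+j]≡±2c = ≡±-trans (≡±-reflexive (a*[2*t]≡2*[a*t] (2 ^ j))) (≡±-*ˡ 2 (modStar-≡± (a * 2 ^ j)))

  modStar-2^period≡1 : 3 ≤ n → ∀ {P} → (∀ l → schick n 1 (l + P) ≡ schick n 1 l) → modStar n (2 ^ P) ≡ 1
  modStar-2^period≡1 3≤n {P} periodic = *-cancelˡ-≡ _ 1 2 (+-cancelʳ-≡ ∣ n - 2 ∣ _ 2 (begin
    2 * modStar n (2 ^ P) + ∣ n - 2 ∣               ≡⟨ cong₂ (λ c d → 2 * modStar n c + d)
                                                         (*-identityˡ (2 ^ P)) (periodic 1) ⟨
    2 * modStar n (1 * 2 ^ P) + schick n 1 (suc P)  ≡⟨ modStar-schick 3≤n P ⟩
    n                                               ≡⟨ m≤n⇒m+∣n-m∣≡n (<⇒≤ 3≤n) ⟨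
    2 + ∣ n - 2 ∣                                   ∎))
    where open ≡-Reasoning

InputsRev⇒2*head< : ∀ {b a as} → 3 ≤ b → InputsRev b (a ∷ as) → 2 * a < b
InputsRev⇒2*head< 3≤b first = 3≤b
InputsRev⇒2*head< {suc _} _ (next _ ((_ , 2a≤b-1 , _) , _)) = s≤s 2a≤b-1

proposition35 : ∀ (b : ℕ) → 3 ≤ b → b % 2 ≡ 1 →
    ∀ (i a : ℕ) → IsMDSInput b i a →
    ∀ (P : ℕ) → IsPes b P →
    (∀ (j : ℕ) → 1 ≤ j → j ≤ P →
      2 * modStar b (a * 2 ^ j) + schick b a (suc j) ≡ b)
    × modStar b (a * 2 ^ P) ≡ schick b a 0
proposition35 b@(suc _) 3≤b b-odd i a (_ , inputs , _) P (_ , periodic , _) =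
  (λ j _ _ → modStar-schick b-odd 2a<b j) , modStar-unique b-odd a2^P≡±a 2a<b
  where
  2a<b : 2 * a < b
  2a<b = InputsRev⇒2*head< 3≤b inputs
  2^P≡±1 : 2 ^ P ≡± 1 [mod b ]
  2^P≡±1 = subst (2 ^ P ≡±_[mod b ]) (modStar-2^period≡1 b-odd 3≤b periodic) (modStar-≡± (2 ^ P))
  a2^P≡±a : a * 2 ^ P ≡± a [mod b ]
  a2^P≡±a = ≡±-trans {y = a * 1} (≡±-*ˡ a 2^P≡±1) (≡±-reflexive (*-identityʳ a))
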